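{- Let $H$ be a digraph (possibly with loops), $D$ an $H$-colored digraph, $\mathscr{F}$ a walk-preservative $H$-class partition of $A(D)$, and $k,l\in\mathbb{N}$ with $k\geq 2$, $l\geq 1$. If $\mathcal{S}$ is a $(k,l)$-kernel in $C_{\mathscr{F}}(D)$ such that $N^{+}(\mathcal{S})=\emptyset$, then $D$ has a $(k,l+1,H)$-kernel by walks.
   Context: An $H$-colored digraph is a finite digraph $D$ without loops with a coloring $\rho:A(D)\to V(H)$. For $F\subseteq A(D)$, $D\langle F\rangle$ is the digraph with arc set $F$ and vertex set the vertices incident with an arc of $F$. An $H$-class partition of $A(D)$ is a partition $\mathscr{F}$ of $A(D)$ such that for all arcs $(u,v),(v,w)$ of $D$, $(\rho(u,v),\rho(v,w))\in A(H)$ iff some $F\in\mathscr{F}$ contains both arcs. The $H$-class digraph $C_{\mathscr{F}}(D)$ has vertex set $\mathscr{F}$, and $(F,G)$ (possibly a loop) is an arc iff there exist $(u,v)\in F$ and $(v,w)\in G$. $\mathscr{F}$ is walk-preservative if for every arc $(F,G)$ of $C_{\mathscr{F}}(D)$ and every $z\in V(D\langle F\rangle)$ there is a $zw$-path in $D\langle F\rangle$ for some $w\in V(D\langle G\rangle)$. For a set $\mathcal{S}$ of vertices of a digraph, $N^+(\mathcal{S})$ denotes the proper out-neighborhood: vertices not in $\mathcal{S}$ that receive an arc from a vertex of $\mathcal{S}$. For a digraph $G$ and $k\ge2$, $l\ge1$, a $(k,l)$-kernel is a set $S\subseteq V(G)$ such that every walk between two different vertices of $S$ has length at least $k$, and every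 vertex not in $S$ has a walk of length at most $l$ to $S$. For a walk $W=(x_0,\ldots,x_n)$ in $D$, there is an obstruction on $x_i$ if $(\rho(x_{i-1},x_i),\rho(x_i,x_{i+1}))\notin A(H)$; for open $W$, $O_H(W)$ is the set of $i\in\{1,\dots,n-1\}$ with an obstruction on $x_i$ and the $H$-length is $l_H(W)=|O_H(W)|+1$. A set $S\subseteq V(D)$ is a $(k,l,H)$-kernel by walks if every walk between two different vertices of $S$ has $H$-length at least $k$ and every $x\notin S$ has a walk to a vertex of $S$ of $H$-length at most $l$. -}

module Defs where

open import Level using (0ℓ)
open import Data.Nat using (ℕ; zero; suc; _+_; _≤_)
open import Data.Fin using (Fin)
open import Data.Bool using (if_then_else_)
open import Data.Product using (Σ; ∃; ∃₂; _×_; _,_)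
open import Data.Sum using (_⊎_)
open import Data.List using (List; []; _∷_)
open import Data.List.Relation.Unary.All using (All)
open import Data.List.Relation.Unary.Unique.Propositional using (Unique)
open import Relation.Nullary using (¬_; Dec; ⌊_⌋)
open import Relation.Unary using (Pred)
open import Relation.Binary.PropositionalEquality using (_≡_; _≢_)

record Digraph : Set₁ where
  field
    order : ℕ
    Arc   : Fin order → Fin order → Set
    arc?  : ∀ u v → Dec (Arc u v)

data Walk {V : Set} (E : V → V → Set) : V → V → ℕ → Set where
  nilʷ  : ∀ {x} → Walk E x x 0
  consʷ : ∀ {x y z n} → E x y → Walk E y z n → Walk E x z (suc n)

IsKLKernel : {V : Set} (E : V → V → Set) (k l : ℕ) (S : Pred V 0ℓ) → Set
IsKLKernel {V} E k l S =
  (∀ u v → S u → S v → u ≢ v → ∀ n → Walk E u v n → k ≤ n)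
  × (∀ u → ¬ S u → ∃ λ v → S v × ∃ λ n → n ≤ l × Walk E u v n)

OutNeighbourhoodEmpty : {V : Set} (E : V → V → Set) (S : Pred V 0ℓ) → Set
OutNeighbourhoodEmpty {V} E S = ∀ v → ¬ S v → ¬ (∃ λ u → S u × E u v)

record HColoredDigraph (H : Digraph) : Set where
  field
    order    : ℕ
    size     : ℕ
    tail     : Fin size → Fin order
    head     : Fin size → Fin order
    loopless : ∀ a → tail a ≢ head a
    simple   : ∀ a b → tail a ≡ tail b → head a ≡ head b → a ≡ b
    ρ        : Fin size → Fin (Digraph.order H)

module _ {H : Digraph} (D : HColoredDigraph H) where
  open HColoredDigraph D
  open Digraph H using (Arc; arc?)

  data DWalk : Fin order → Fin order → Set where
    nil  : ∀ {x} → DWalk x x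
    cons : ∀ {x y} (a : Fin size) → tail a ≡ x → DWalk (head a) y → DWalk x y

  walkVertices : ∀ {x y} → DWalk x y → List (Fin order)
  walkVertices {x} nil = x ∷ []
  walkVertices {x} (cons a _ w) = x ∷ walkVertices w

  walkArcs : ∀ {x y} → DWalk x y → List (Fin size)
  walkArcs nil = []
  walkArcs (cons a _ w) = a ∷ walkArcs w

  obstructions : ∀ {x y} → DWalk x y → ℕ
  obstructions nil = 0
  obstructions (cons a _ nil) = 0
  obstructions (cons a _ (cons b e w)) =
    (if ⌊ arc? (ρ a) (ρ b) ⌋ then 0 else 1) + obstructions (cons b e w)

  HLength : ∀ {x y} → DWalk x y → ℕ
  HLength w = suc (obstructions w)

  IsKLHKernelByWalks : (k l : ℕ) (S : Pred (Fin order) 0ℓ) → Set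
  IsKLHKernelByWalks k l S =
    (∀ u v → S u → S v → u ≢ v → (W : DWalk u v) → k ≤ HLength W)
    × (∀ x → ¬ S x → ∃ λ y → S y × Σ (DWalk x y) λ W → HLength W ≤ l)

  -- A partition of A(D) into p classes, given by the class of each arc
  -- (every class nonempty), which is an H-class partition.
  IsHClassPartition : {p : ℕ} → (Fin size → Fin p) → Set
  IsHClassPartition {p} cls =
    (∀ F → ∃ λ a → cls a ≡ F)
    × (∀ a b → head a ≡ tail b →
         (Arc (ρ a) (ρ b) → cls a ≡ cls b) × (cls a ≡ cls b → Arc (ρ a) (ρ b)))

  ClassArc : {p : ℕ} → (Fin size → Fin p) → Fin p → Fin p → Set
  ClassArc cls F G = ∃₂ λ a b → head a ≡ tail b × cls a ≡ F × cls b ≡ G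

  InClassSubdigraph : {p : ℕ} → (Fin size → Fin p) → Fin p → Fin order → Set
  InClassSubdigraph cls F z = ∃ λ a → cls a ≡ F × (tail a ≡ z ⊎ head a ≡ z)

  IsPathIn : {p : ℕ} → (Fin size → Fin p) → Fin p → ∀ {z w} → DWalk z w → Set
  IsPathIn cls F W = All (λ a → cls a ≡ F) (walkArcs W) × Unique (walkVertices W)

  IsWalkPreservative : {p : ℕ} → (Fin size → Fin p) → Set
  IsWalkPreservative cls =
    ∀ F G → ClassArc cls F G → ∀ z → InClassSubdigraph cls F z →
      ∃ λ w → InClassSubdigraph cls G w × Σ (DWalk z w) λ W → IsPathIn cls F W

{-# OPTIONS --safe #-}
-- Let T consist of the least vertex of each terminal strong component of D.
-- No walk joins two distinct vertices of T, so T is independent for every k.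
-- Because N⁺(S) = ∅ and k ≥ 2, every class of S is closed: an arc following
-- an arc of the class lies in the class again, so from such a class T is
-- reached by a monochromatic walk, i.e. without obstructions.  A vertex x ∉ T
-- has an out-arc a; if its class is not closed it is not in S, and a walk of
-- length n ≤ l from it to S in C_F(D), lifted to D by walk preservation,
-- changes class (and so meets an obstruction) at most n times before entering
-- a class of S.  Hence x reaches T with H-length at most l + 1.
module Submission where

open import Defs
open import Level using (0ℓ)
open import Data.Nat using (ℕ; zero; suc; _+_; _≤_; _<_; z≤n; s≤s)
open import Data.Nat.Properties
  using (≤-refl; ≤-reflexive; ≤-trans; ≤-antisym; <-trans; <-irrefl; ≮⇒≥;
         _<?_; n≤1+n; +-monoˡ-≤; +-monoʳ-≤; +-suc; +-assoc)
open import Data.Fin using (Fin; zero; suc; toℕ; _≟_)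
open import Data.Fin.Properties using (any?; all?; toℕ-injective; injective⇒≤)
open import Data.Fin.Induction using (spo-wellFounded)
open import Data.Product using (Σ; ∃; _×_; _,_; proj₁; proj₂)
open import Data.Sum using (_⊎_; inj₁; inj₂)
open import Data.Bool using (if_then_else_)
open import Data.List using (List; []; _∷_; length; lookup)
open import Data.List.Relation.Unary.All as All using (All; []; _∷_)
open import Data.List.Relation.Unary.All.Properties using (¬Any⇒All¬)
open import Data.List.Relation.Unary.AllPairs using ([]; _∷_)
open import Data.List.Relation.Unary.Any using (here; there)
open import Data.List.Relation.Unary.Unique.Propositional using (Unique)
open import Data.List.Membership.Propositional using (_∈_)
open import Data.List.Membership.Propositional.Properties using (∈-lookup)
import Data.List.Membership.DecPropositional as DecMembership
open import Function.Definitions using (Injective)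
open import Induction.WellFounded using (WellFounded; Acc; acc)
open import Relation.Nullary using (¬_; Dec; yes; no; ⌊_⌋; contradiction)
open import Relation.Nullary.Decidable using (_×-dec_; _⊎-dec_; _→-dec_; ¬?)
open import Relation.Unary using (Pred)
open import Relation.Binary.Structures using (IsStrictPartialOrder)
open import Relation.Binary.PropositionalEquality
  using (_≡_; _≢_; refl; sym; trans; cong; resp₂; isEquivalence)

lookup-injective : ∀ {A : Set} {xs : List A} → Unique xs → Injective _≡_ _≡_ (lookup xs)
lookup-injective (_ ∷ _) {zero} {zero} _ = refl
lookup-injective (x∉xs ∷ _) {zero} {suc j} eq = contradiction eq (All.lookup x∉xs (∈-lookup j))
lookup-injective (x∉xs ∷ _) {suc i} {zero} eq = contradiction (sym eq) (All.lookup x∉xs (∈-lookup i))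
lookup-injective (_ ∷ u) {suc i} {suc j} eq = cong suc (lookup-injective u eq)

Unique⇒length≤ : ∀ {n} {xs : List (Fin n)} → Unique xs → length xs ≤ n
Unique⇒length≤ u = injective⇒≤ (lookup-injective u)

module Walks {H : Digraph} (D : HColoredDigraph H) where
  open HColoredDigraph D
  open Digraph H using (Arc; arc?)

  Vertex : Set
  Vertex = Fin order

  Walkᴰ : Vertex → Vertex → Set
  Walkᴰ = DWalk D

  _++ʷ_ : ∀ {x y z} → Walkᴰ x y → Walkᴰ y z → Walkᴰ x z
  nil ++ʷ w = w
  cons a e v ++ʷ w = cons a e (v ++ʷ w)

  infixr 5 _++ʷ_

  IsPath : ∀ {x y} → Walkᴰ x y → Set
  IsPath w = Unique (walkVertices D w)

  path-suffix : ∀ {x y z} (w : Walkᴰ y z) → IsPath w → x ∈ walkVertices D w →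
    Σ (Walkᴰ x z) IsPath
  path-suffix nil u (here refl) = nil , u
  path-suffix (cons a e w) u (here refl) = cons a e w , u
  path-suffix (cons a e w) (_ ∷ u) (there x∈w) = path-suffix w u x∈w

  open DecMembership {A = Vertex} _≟_ using (_∈?_)

  walk⇒path : ∀ {x y} → Walkᴰ x y → Σ (Walkᴰ x y) IsPath
  walk⇒path nil = nil , ([] ∷ [])
  walk⇒path {x} (cons a e w) with walk⇒path w
  ... | p , u with x ∈? walkVertices D p
  ...   | yes x∈p = path-suffix p u x∈p
  ...   | no x∉p = cons a e p , (¬Any⇒All¬ _ x∉p ∷ u)

  BoundedWalk : ℕ → Vertex → Vertex → Set
  BoundedWalk n x y = Σ (Walkᴰ x y) λ w → length (walkVertices D w) ≤ n

  boundedWalk? : ∀ n x y → Dec (BoundedWalk n x y)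
  boundedWalk? zero x y = no λ { (nil , ()) ; (cons _ _ _ , ()) }
  boundedWalk? (suc n) x y with x ≟ y
  ... | yes refl = yes (nil , s≤s z≤n)
  ... | no x≢y with any? (λ a → (tail a ≟ x) ×-dec boundedWalk? n (head a) y)
  ...   | yes (a , e , w , w≤n) = yes (cons a e w , s≤s w≤n)
  ...   | no ¬step = no λ { (nil , _) → x≢y refl
                          ; (cons a e w , s≤s w≤n) → ¬step (a , e , w , w≤n) }

  walk? : ∀ x y → Dec (Walkᴰ x y)
  walk? x y with boundedWalk? order x y
  ... | yes (w , _) = yes w
  ... | no ¬short = no λ w → let p , u = walk⇒path w in ¬short (p , Unique⇒length≤ u)

  -- w ⊏ x : w is reachable from x, and either not conversely or w has the
  -- smaller index.  Its minimal elements are the least vertices of the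
  -- terminal strong components.
  _⊏_ : Vertex → Vertex → Set
  w ⊏ x = Walkᴰ x w × (¬ Walkᴰ w x ⊎ toℕ w < toℕ x)

  ⊏-irrefl : ∀ {x y} → x ≡ y → ¬ (x ⊏ y)
  ⊏-irrefl refl (_ , inj₁ ¬xx) = ¬xx nil
  ⊏-irrefl refl (_ , inj₂ x<x) = <-irrefl refl x<x

  ⊏-trans : ∀ {u w x} → u ⊏ w → w ⊏ x → u ⊏ x
  ⊏-trans (wu , inj₁ ¬uw) (xw , _) = xw ++ʷ wu , inj₁ λ ux → ¬uw (ux ++ʷ xw)
  ⊏-trans (wu , inj₂ _) (xw , inj₁ ¬wx) = xw ++ʷ wu , inj₁ λ ux → ¬wx (wu ++ʷ ux)
  ⊏-trans (wu , inj₂ u<w) (xw , inj₂ w<x) = xw ++ʷ wu , inj₂ (<-trans u<w w<x)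

  ⊏-isStrictPartialOrder : IsStrictPartialOrder _≡_ _⊏_
  ⊏-isStrictPartialOrder = record
    { isEquivalence = isEquivalence
    ; irrefl = ⊏-irrefl
    ; trans = ⊏-trans
    ; <-resp-≈ = resp₂ _⊏_
    }

  ⊏-wellFounded : WellFounded _⊏_
  ⊏-wellFounded = spo-wellFounded ⊏-isStrictPartialOrder

  _⊏?_ : ∀ w x → Dec (w ⊏ x)
  w ⊏? x = walk? x w ×-dec (¬? (walk? w x) ⊎-dec (toℕ w <? toℕ x))

  Terminal : Pred Vertex 0ℓ
  Terminal t = ∀ w → Walkᴰ t w → Walkᴰ w t × toℕ t ≤ toℕ w

  ⊏-minimal⇒Terminal : ∀ {t} → (∀ w → ¬ (w ⊏ t)) → Terminal t
  ⊏-minimal⇒Terminal {t} min w tw with walk? w t | toℕ w <? toℕ t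
  ... | no ¬wt | _ = contradiction (tw , inj₁ ¬wt) (min w)
  ... | yes _ | yes w<t = contradiction (tw , inj₂ w<t) (min w)
  ... | yes wt | no w≮t = wt , ≮⇒≥ w≮t

  Terminal-reachable : ∀ x → ∃ λ t → Terminal t × Walkᴰ x t
  Terminal-reachable x = go x (⊏-wellFounded x)
    where
    go : ∀ x → Acc _⊏_ x → ∃ λ t → Terminal t × Walkᴰ x t
    go x (acc rec) with any? (_⊏? x)
    ... | yes (w , w⊏x) = let t , term , wt = go w (rec w⊏x) in t , term , proj₁ w⊏x ++ʷ wt
    ... | no ¬below = x , ⊏-minimal⇒Terminal (λ w w⊏x → ¬below (w , w⊏x)) , nil

  Terminal-walk⇒≡ : ∀ {u v} → Terminal u → Terminal v → Walkᴰ u v → u ≡ v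
  Terminal-walk⇒≡ {u} {v} term-u term-v uv =
    let vu , u≤v = term-u v uv in toℕ-injective (≤-antisym u≤v (proj₂ (term-v u vu)))

  sink⇒Terminal : ∀ {x} → (∀ a → tail a ≢ x) → Terminal x
  sink⇒Terminal _ _ nil = nil , ≤-refl
  sink⇒Terminal no-out _ (cons a e _) = contradiction e (no-out a)

  obstructionAt : Fin size → Fin size → ℕ
  obstructionAt a b = if ⌊ arc? (ρ a) (ρ b) ⌋ then 0 else 1

  obstructionAt≤1 : ∀ a b → obstructionAt a b ≤ 1
  obstructionAt≤1 a b with arc? (ρ a) (ρ b)
  ... | yes _ = z≤n
  ... | no _ = s≤s z≤n

  obstructionAt-arc : ∀ {a b} → Arc (ρ a) (ρ b) → obstructionAt a b ≡ 0
  obstructionAt-arc {a} {b} ab with arc? (ρ a) (ρ b)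
  ... | yes _ = refl
  ... | no ¬ab = contradiction ab ¬ab

  -- The junction vertex y carries at most one further obstruction.
  obstructions-++ : ∀ {x y z} (v : Walkᴰ x y) (w : Walkᴰ y z) →
    obstructions D (v ++ʷ w) ≤ suc (obstructions D v + obstructions D w)
  obstructions-++ nil w = n≤1+n _
  obstructions-++ (cons a e nil) nil = z≤n
  obstructions-++ (cons a e nil) (cons b e′ w) =
    +-monoˡ-≤ (obstructions D (cons b e′ w)) (obstructionAt≤1 a b)
  obstructions-++ (cons a e (cons b e′ v)) w =
    ≤-trans (+-monoʳ-≤ (obstructionAt a b) (obstructions-++ (cons b e′ v) w))
      (≤-reflexive (trans (+-suc (obstructionAt a b) _)
                          (cong suc (sym (+-assoc (obstructionAt a b) _ _)))))

  Terminal-independent : ∀ k u v → Terminal u → Terminal v → u ≢ v →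
    (w : Walkᴰ u v) → k ≤ HLength D w
  Terminal-independent _ _ _ term-u term-v u≢v w =
    contradiction (Terminal-walk⇒≡ term-u term-v w) u≢v

module ClassPartition {H : Digraph} (D : HColoredDigraph H) {p : ℕ}
  (cls : Fin (HColoredDigraph.size D) → Fin p) (part : IsHClassPartition D cls) where
  open HColoredDigraph D
  open Walks D

  Monochromatic : Fin p → ∀ {x y} → Walkᴰ x y → Set
  Monochromatic G w = All (λ a → cls a ≡ G) (walkArcs D w)

  monochromatic⇒obstructions≡0 : ∀ {G x y} (w : Walkᴰ x y) → Monochromatic G w →
    obstructions D w ≡ 0
  monochromatic⇒obstructions≡0 nil _ = refl
  monochromatic⇒obstructions≡0 (cons _ _ nil) _ = refl
  monochromatic⇒obstructions≡0 (cons a _ (cons b e w)) (a∈G ∷ b∈G ∷ w∈G) =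
    trans (cong (_+ obstructions D (cons b e w)) (obstructionAt-arc ab))
          (monochromatic⇒obstructions≡0 (cons b e w) (b∈G ∷ w∈G))
    where ab = proj₂ (proj₂ part a b (sym e)) (trans a∈G (sym b∈G))

  Closed : Fin p → Set
  Closed G = ∀ a b → head a ≡ tail b → cls a ≡ G → cls b ≡ G

  closed? : ∀ G → Dec (Closed G)
  closed? G = all? λ a → all? λ b → (head a ≟ tail b) →-dec ((cls a ≟ G) →-dec (cls b ≟ G))

  Closed⇒monochromatic : ∀ {G} → Closed G → ∀ a {y} → cls a ≡ G →
    (w : Walkᴰ (head a) y) → Monochromatic G w
  Closed⇒monochromatic closed a a∈G nil = []
  Closed⇒monochromatic closed a a∈G (cons b e w) =
    b∈G ∷ Closed⇒monochromatic closed b b∈G w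
    where b∈G = closed a b (sym e) a∈G

  Closed⇒Terminal-reachable : ∀ {G} → Closed G → ∀ z → InClassSubdigraph D cls G z →
    ∃ λ t → Terminal t × Σ (Walkᴰ z t) λ w → obstructions D w ≡ 0
  Closed⇒Terminal-reachable closed z (a , a∈G , inj₂ refl) =
    let t , term , w = Terminal-reachable (head a)
    in t , term , w , monochromatic⇒obstructions≡0 w (Closed⇒monochromatic closed a a∈G w)
  Closed⇒Terminal-reachable closed z (a , a∈G , inj₁ e) =
    let t , term , w = Terminal-reachable (head a)
    in t , term , cons a e w ,
       monochromatic⇒obstructions≡0 (cons a e w) (a∈G ∷ Closed⇒monochromatic closed a a∈G w)

  module _ (wp : IsWalkPreservative D cls) where

    classWalk-lift : ∀ {F G n} → Walk (ClassArc D cls) F G n → Closed G →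
      ∀ z → InClassSubdigraph D cls F z →
      ∃ λ t → Terminal t × Σ (Walkᴰ z t) λ w → obstructions D w ≤ n
    classWalk-lift nilʷ closed z z∈F =
      let t , term , w , w≡0 = Closed⇒Terminal-reachable closed z z∈F
      in t , term , w , ≤-reflexive w≡0
    classWalk-lift (consʷ FF′ rest) closed z z∈F =
      let y , y∈F′ , v , v∈F , _ = wp _ _ FF′ z z∈F
          t , term , w , w≤n = classWalk-lift rest closed y y∈F′
          v+w≤n = ≤-trans (≤-reflexive (cong (_+ obstructions D w)
                            (monochromatic⇒obstructions≡0 v v∈F))) w≤n
      in t , term , v ++ʷ w , ≤-trans (obstructions-++ v w) (s≤s v+w≤n)

    module _ {k l : ℕ} (2≤k : 2 ≤ k) {S : Pred (Fin p) 0ℓ}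
      (ker : IsKLKernel (ClassArc D cls) k l S)
      (no-out : OutNeighbourhoodEmpty (ClassArc D cls) S) where

      S⇒Closed : ∀ {F} → S F → Closed F
      S⇒Closed {F} F∈S a b ab a∈F with cls b ≟ F
      ... | yes b∈F = b∈F
      ... | no b∉F = contradiction (F , F∈S , FG) (no-out (cls b) G∉S)
        where
        FG : ClassArc D cls F (cls b)
        FG = a , b , ab , a∈F , refl
        G∉S : ¬ S (cls b)
        G∉S G∈S with ≤-trans 2≤k (proj₁ ker F (cls b) F∈S G∈S (λ eq → b∉F (sym eq)) 1 (consʷ FG nilʷ))
        ... | s≤s ()

      Terminal-absorbs : ∀ x → ¬ Terminal x →
        ∃ λ t → Terminal t × Σ (Walkᴰ x t) λ w → HLength D w ≤ suc l
      Terminal-absorbs x ¬term with any? (λ a → tail a ≟ x)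
      ... | no ¬out = contradiction (sink⇒Terminal λ a e → ¬out (a , e)) ¬term
      ... | yes (a , e) with closed? (cls a)
      ...   | yes closed =
        let t , term , w , w≡0 = Closed⇒Terminal-reachable closed x (a , refl , inj₁ e)
        in t , term , w , s≤s (≤-trans (≤-reflexive w≡0) z≤n)
      ...   | no ¬closed =
        let G , G∈S , n , n≤l , aG = proj₂ ker (cls a) (λ a∈S → ¬closed (S⇒Closed a∈S))
            t , term , w , w≤n = classWalk-lift aG (S⇒Closed G∈S) x (a , refl , inj₁ e)
        in t , term , w , s≤s (≤-trans w≤n n≤l)

theorem5 : (H : Digraph) (D : HColoredDigraph H) (p : ℕ)
    (cls : Fin (HColoredDigraph.size D) → Fin p) →
    IsHClassPartition D cls → IsWalkPreservative D cls →
    (k l : ℕ) → 2 ≤ k → 1 ≤ l →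
    (S : Pred (Fin p) 0ℓ) →
    IsKLKernel (ClassArc D cls) k l S →
    OutNeighbourhoodEmpty (ClassArc D cls) S →
    ∃ λ (T : Pred (Fin (HColoredDigraph.order D)) 0ℓ) → IsKLHKernelByWalks D k (suc l) T
theorem5 H D p cls part wp k l 2≤k _ S ker no-out =
  Terminal , Terminal-independent k , Terminal-absorbs part wp 2≤k ker no-out
  where
  open Walks D
  open ClassPartition D cls
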